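{- Let $G$ be a finite bipartite graph and $b:V(G)\to\mathbb{Z}_{\ge0}$. If $Z\subseteq V(G)$ is a $b$-verifying set, then for every maximum $b$-matching $M$: (i) $E[Z]\subseteq M$; (ii) $E[V(G)\setminus Z]\cap M=\emptyset$; (iii) every $M$-loose vertex belongs to $Z$. Consequently every edge of $E[Z]$ is inevitable and every edge of $E[V(G)\setminus Z]$ is forbidden.
   Context: A $b$-matching is $M\subseteq E(G)$ with at most $b(v)$ edges of $M$ at each vertex $v$; maximum = largest cardinality; $v$ is $M$-loose if fewer than $b(v)$ edges of $M$ are incident with it. An edge is allowed if in some maximum $b$-matching, forbidden otherwise; an allowed edge is inevitable if in every maximum $b$-matching. For $X\subseteq V(G)$, $E[X]$ is the set of edges with both ends in $X$ and $b(X)=\sum_{v\in X}b(v)$. $Z$ is a $b$-verifying set if $b(V(G)\setminus Z)+|E[Z]|$ equals the size of a maximum $b$-matching. -}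

module Defs where

open import Data.Nat using (ℕ; zero; suc; _+_; _≤_; _<_; _<ᵇ_)
open import Data.Bool using (Bool; true; false; _∧_; if_then_else_; not)
open import Data.Fin using (Fin; toℕ)
open import Data.Product using (Σ; _×_; ∃)
open import Relation.Nullary using (¬_)
open import Relation.Binary.PropositionalEquality using (_≡_; _≢_)

Σ[_] : ∀ {n} → (Fin n → ℕ) → ℕ
Σ[_] {zero}  f = 0
Σ[_] {suc n} f = f Fin.zero + Σ[_] {n} (λ i → f (Fin.suc i))

[_]₀₁ : Bool → ℕ
[ true ]₀₁  = 1
[ false ]₀₁ = 0

record Graph : Set where
  field
    n      : ℕ
    adj    : Fin n → Fin n → Bool
    adj-sym   : ∀ u v → adj u v ≡ adj v u
    adj-irrefl : ∀ v → adj v v ≡ false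
open Graph public

IsBipartite : Graph → Set
IsBipartite G = Σ (Fin (n G) → Bool) λ c →
  ∀ u v → adj G u v ≡ true → c u ≢ c v

-- An edge subset is represented by a symmetric Boolean relation
-- (contained in the adjacency relation, enforced where needed).
EdgeSubset : Graph → Set
EdgeSubset G = Fin (n G) → Fin (n G) → Bool

-- Number of edges of an edge subset: unordered pairs {u,v} (u < v) in S.
edgeCount : (G : Graph) → EdgeSubset G → ℕ
edgeCount G S = Σ[ (λ u → Σ[ (λ v → [ (toℕ u <ᵇ toℕ v) ∧ S u v ]₀₁) ] ) ]

deg : (G : Graph) → EdgeSubset G → Fin (n G) → ℕ
deg G S v = Σ[ (λ u → [ S v u ]₀₁) ]

IsBMatching : (G : Graph) → (Fin (n G) → ℕ) → EdgeSubset G → Set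
IsBMatching G b M =
  (∀ u v → M u v ≡ true → adj G u v ≡ true) ×
  (∀ u v → M u v ≡ M v u) ×
  (∀ v → deg G M v ≤ b v)

IsMaxBMatching : (G : Graph) → (Fin (n G) → ℕ) → EdgeSubset G → Set
IsMaxBMatching G b M =
  IsBMatching G b M × (∀ M' → IsBMatching G b M' → edgeCount G M' ≤ edgeCount G M)

IsLoose : (G : Graph) → (Fin (n G) → ℕ) → EdgeSubset G → Fin (n G) → Set
IsLoose G b M v = deg G M v < b v

VSubset : Graph → Set
VSubset G = Fin (n G) → Bool

bOf : (G : Graph) → (Fin (n G) → ℕ) → VSubset G → ℕ
bOf G b X = Σ[ (λ v → if X v then b v else 0) ]

complement : (G : Graph) → VSubset G → VSubset G
complement G X v = not (X v)

inducedEdges : (G : Graph) → VSubset G → EdgeSubset G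
inducedEdges G X u v = adj G u v ∧ X u ∧ X v

IsBVerifying : (G : Graph) → (Fin (n G) → ℕ) → VSubset G → Set
IsBVerifying G b Z = Σ (EdgeSubset G) λ M →
  IsMaxBMatching G b M ×
  (bOf G b (complement G Z) + edgeCount G (inducedEdges G Z) ≡ edgeCount G M)

Allowed : (G : Graph) → (Fin (n G) → ℕ) → Fin (n G) → Fin (n G) → Set
Allowed G b u v = Σ (EdgeSubset G) λ M → IsMaxBMatching G b M × (M u v ≡ true)

Inevitable : (G : Graph) → (Fin (n G) → ℕ) → Fin (n G) → Fin (n G) → Set
Inevitable G b u v =
  Allowed G b u v × (∀ M → IsMaxBMatching G b M → M u v ≡ true)

Forbidden : (G : Graph) → (Fin (n G) → ℕ) → Fin (n G) → Fin (n G) → Set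
Forbidden G b u v = ¬ Allowed G b u v

-- For every b-matching M and every vertex set Z,
--   |M| + |E[Z] ∖ M| + |M ∩ E[V∖Z]| + Σ_{v ∉ Z} (b(v) − deg_M v) = |E[Z]| + b(V∖Z) :
-- an edge of M inside Z is counted on both sides, an edge of M leaving Z
-- uses capacity of its endpoints outside Z, and the slack of those endpoints
-- accounts for the rest of b(V∖Z).  If Z is b-verifying and M is maximum,
-- the right-hand side is at most |M|, so the three defect terms vanish,
-- which is exactly (i), (ii) and (iii).
module Submission where

open import Defs
open import Data.Bool using (Bool; true; false; _∧_; not; if_then_else_; T)
open import Data.Bool.Properties using (∧-zeroʳ; ∧-identityʳ; not-injective)
open import Data.Empty using (⊥-elim)
open import Data.Fin using (Fin; toℕ)
open import Data.Fin.Properties using (toℕ-injective)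
open import Data.Nat using (ℕ; zero; suc; _+_; _∸_; _≤_; _<_; _<ᵇ_)
open import Data.Nat.Properties
open import Algebra.Properties.CommutativeMonoid.Sum +-0-commutativeMonoid using (sum; ∑-distrib-+)
open import Data.Product using (_×_; _,_; proj₁; proj₂)
open import Function using (_∘_)
open import Relation.Binary.PropositionalEquality

Σ≡sum : ∀ {k} (f : Fin k → ℕ) → Σ[ f ] ≡ sum f
Σ≡sum {zero}  f = refl
Σ≡sum {suc k} f = cong (f Fin.zero +_) (Σ≡sum (f ∘ Fin.suc))

Σ-cong : ∀ {k} {f g : Fin k → ℕ} → (∀ i → f i ≡ g i) → Σ[ f ] ≡ Σ[ g ]
Σ-cong {zero}  f≗g = refl
Σ-cong {suc k} f≗g = cong₂ _+_ (f≗g Fin.zero) (Σ-cong (f≗g ∘ Fin.suc))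

Σ-zero : ∀ {k} → Σ[ (λ (i : Fin k) → 0) ] ≡ 0
Σ-zero {zero}  = refl
Σ-zero {suc k} = Σ-zero {k}

Σ-distrib-+ : ∀ {k} (f g : Fin k → ℕ) → Σ[ (λ i → f i + g i) ] ≡ Σ[ f ] + Σ[ g ]
Σ-distrib-+ f g = begin
  Σ[ (λ i → f i + g i) ] ≡⟨ Σ≡sum (λ i → f i + g i) ⟩
  sum (λ i → f i + g i)  ≡⟨ ∑-distrib-+ f g ⟩
  sum f + sum g          ≡⟨ cong₂ _+_ (Σ≡sum f) (Σ≡sum g) ⟨
  Σ[ f ] + Σ[ g ]        ∎
  where open ≡-Reasoning

Σ-comm : ∀ {k l} (f : Fin k → Fin l → ℕ) →
  Σ[ (λ i → Σ[ f i ]) ] ≡ Σ[ (λ j → Σ[ (λ i → f i j) ]) ]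
Σ-comm {zero}  {l} f = sym (Σ-zero {l})
Σ-comm {suc k}     f = trans (cong (Σ[ f Fin.zero ] +_) (Σ-comm (f ∘ Fin.suc)))
  (sym (Σ-distrib-+ (f Fin.zero) (λ j → Σ[ (λ i → f (Fin.suc i) j) ])))

Σ≡0⇒≡0 : ∀ {k} (f : Fin k → ℕ) → Σ[ f ] ≡ 0 → ∀ i → f i ≡ 0
Σ≡0⇒≡0 f Σf≡0 Fin.zero    = m+n≡0⇒m≡0 (f Fin.zero) Σf≡0
Σ≡0⇒≡0 f Σf≡0 (Fin.suc i) = Σ≡0⇒≡0 (f ∘ Fin.suc) (m+n≡0⇒n≡0 (f Fin.zero) Σf≡0) i

Σ-if-+-∸ : ∀ {k} (X : Fin k → Bool) {f g : Fin k → ℕ} → (∀ i → f i ≤ g i) →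
  Σ[ (λ i → if X i then f i else 0) ] + Σ[ (λ i → if X i then g i ∸ f i else 0) ]
  ≡ Σ[ (λ i → if X i then g i else 0) ]
Σ-if-+-∸ X {f} {g} f≤g =
  trans (sym (Σ-distrib-+ (λ i → if X i then f i else 0) (λ i → if X i then g i ∸ f i else 0)))
        (Σ-cong split)
  where
    split : ∀ i → (if X i then f i else 0) + (if X i then g i ∸ f i else 0)
                  ≡ (if X i then g i else 0)
    split i with X i
    ... | true  = m+[n∸m]≡n (f≤g i)
    ... | false = refl

Σ₂ : ∀ {k} → (Fin k → Fin k → ℕ) → ℕ
Σ₂ f = Σ[ (λ u → Σ[ f u ]) ]

Σ₂-cong : ∀ {k} {f g : Fin k → Fin k → ℕ} → (∀ u v → f u v ≡ g u v) → Σ₂ f ≡ Σ₂ g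
Σ₂-cong f≗g = Σ-cong (λ u → Σ-cong (f≗g u))

Σ₂-distrib-+ : ∀ {k} (f g : Fin k → Fin k → ℕ) →
  Σ₂ (λ u v → f u v + g u v) ≡ Σ₂ f + Σ₂ g
Σ₂-distrib-+ f g =
  trans (Σ-cong (λ u → Σ-distrib-+ (f u) (g u))) (Σ-distrib-+ (λ u → Σ[ f u ]) (λ u → Σ[ g u ]))

[]₀₁≡0⇒false : ∀ {s} → [ s ]₀₁ ≡ 0 → s ≡ false
[]₀₁≡0⇒false {false} _ = refl

_≺_ : ∀ {k} → Fin k → Fin k → Bool
u ≺ v = toℕ u <ᵇ toℕ v

≺⇒< : ∀ {k} {u v : Fin k} → u ≺ v ≡ true → toℕ u < toℕ v
≺⇒< {u = u} {v} u≺v = <ᵇ⇒< (toℕ u) (toℕ v) (subst T (sym u≺v) _)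

⊀⇒≥ : ∀ {k} {u v : Fin k} → u ≺ v ≡ false → toℕ v ≤ toℕ u
⊀⇒≥ u⊀v = ≮⇒≥ (λ u<v → subst T u⊀v (<⇒<ᵇ u<v))

≺-orientations : ∀ {k} (u v : Fin k) (s : Bool) → (u ≡ v → s ≡ false) →
  [ u ≺ v ∧ s ]₀₁ + [ v ≺ u ∧ s ]₀₁ ≡ [ s ]₀₁
≺-orientations u v s loop with u ≺ v in u≺v | v ≺ u in v≺u
... | true  | true  = ⊥-elim (<-asym (≺⇒< {u = u} {v} u≺v) (≺⇒< {u = v} {u} v≺u))
... | true  | false = +-identityʳ [ s ]₀₁
... | false | true  = refl
... | false | false =
  cong [_]₀₁ (sym (loop (toℕ-injective (≤-antisym (⊀⇒≥ {u = v} {u} v≺u) (⊀⇒≥ {u = u} {v} u≺v)))))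

Symmetric Irreflexive : ∀ {k} → (Fin k → Fin k → Bool) → Set
Symmetric   S = ∀ u v → S u v ≡ S v u
Irreflexive S = ∀ u → S u u ≡ false

module _ (G : Graph) where

  edgeCount-+ : {R S T U : EdgeSubset G} →
    (∀ u v → [ R u v ]₀₁ + [ S u v ]₀₁ ≡ [ T u v ]₀₁ + [ U u v ]₀₁) →
    edgeCount G R + edgeCount G S ≡ edgeCount G T + edgeCount G U
  edgeCount-+ {R} {S} {T} {U} pointwise = begin
    edgeCount G R + edgeCount G S
      ≡⟨ Σ₂-distrib-+ (λ u v → [ u ≺ v ∧ R u v ]₀₁) (λ u v → [ u ≺ v ∧ S u v ]₀₁) ⟨
    Σ₂ (λ u v → [ u ≺ v ∧ R u v ]₀₁ + [ u ≺ v ∧ S u v ]₀₁)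
      ≡⟨ Σ₂-cong oriented ⟩
    Σ₂ (λ u v → [ u ≺ v ∧ T u v ]₀₁ + [ u ≺ v ∧ U u v ]₀₁)
      ≡⟨ Σ₂-distrib-+ (λ u v → [ u ≺ v ∧ T u v ]₀₁) (λ u v → [ u ≺ v ∧ U u v ]₀₁) ⟩
    edgeCount G T + edgeCount G U ∎
    where
      open ≡-Reasoning
      oriented : ∀ u v → [ u ≺ v ∧ R u v ]₀₁ + [ u ≺ v ∧ S u v ]₀₁
                         ≡ [ u ≺ v ∧ T u v ]₀₁ + [ u ≺ v ∧ U u v ]₀₁
      oriented u v with u ≺ v
      ... | true  = pointwise u v
      ... | false = refl

  edgeCount-∖-exchange : (S T : EdgeSubset G) →
    edgeCount G S + edgeCount G (λ u v → T u v ∧ not (S u v))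
    ≡ edgeCount G T + edgeCount G (λ u v → S u v ∧ not (T u v))
  edgeCount-∖-exchange S T = edgeCount-+ (λ u v → exchange (S u v) (T u v))
    where
      exchange : ∀ s t → [ s ]₀₁ + [ t ∧ not s ]₀₁ ≡ [ t ]₀₁ + [ s ∧ not t ]₀₁
      exchange false false = refl
      exchange false true  = refl
      exchange true  false = refl
      exchange true  true  = refl

  -- Counting each edge of S at its end in X, once from each orientation,
  -- gives the degree sum over X.
  edgeCount-ends : (S : EdgeSubset G) → Symmetric S → Irreflexive S → (X : VSubset G) →
    edgeCount G (λ u v → X u ∧ S u v) + edgeCount G (λ u v → X v ∧ S u v)
    ≡ Σ[ (λ u → if X u then deg G S u else 0) ]
  edgeCount-ends S S-sym S-irrefl X = begin
    edgeCount G (λ u v → X u ∧ S u v) + edgeCount G (λ u v → X v ∧ S u v)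
      ≡⟨ cong (edgeCount G (λ u v → X u ∧ S u v) +_)
              (Σ-comm (λ v u → [ v ≺ u ∧ (X u ∧ S v u) ]₀₁)) ⟩
    Σ₂ (λ u v → [ u ≺ v ∧ (X u ∧ S u v) ]₀₁) + Σ₂ (λ u v → [ v ≺ u ∧ (X u ∧ S v u) ]₀₁)
      ≡⟨ Σ₂-distrib-+ (λ u v → [ u ≺ v ∧ (X u ∧ S u v) ]₀₁)
                      (λ u v → [ v ≺ u ∧ (X u ∧ S v u) ]₀₁) ⟨
    Σ₂ (λ u v → [ u ≺ v ∧ (X u ∧ S u v) ]₀₁ + [ v ≺ u ∧ (X u ∧ S v u) ]₀₁)
      ≡⟨ Σ₂-cong both-orientations ⟩
    Σ₂ (λ u v → [ X u ∧ S u v ]₀₁)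
      ≡⟨ Σ-cong degree-in-X ⟩
    Σ[ (λ u → if X u then deg G S u else 0) ] ∎
    where
      open ≡-Reasoning
      both-orientations : ∀ u v → [ u ≺ v ∧ (X u ∧ S u v) ]₀₁ + [ v ≺ u ∧ (X u ∧ S v u) ]₀₁
                                  ≡ [ X u ∧ S u v ]₀₁
      both-orientations u v rewrite S-sym v u =
        ≺-orientations u v (X u ∧ S u v) λ { refl → trans (cong (X u ∧_) (S-irrefl u)) (∧-zeroʳ (X u)) }
      degree-in-X : ∀ u → Σ[ (λ v → [ X u ∧ S u v ]₀₁) ] ≡ (if X u then deg G S u else 0)
      degree-in-X u with X u
      ... | true  = refl
      ... | false = Σ-zero {n G}

  edgeCount≡0⇒empty : (S : EdgeSubset G) → Symmetric S → Irreflexive S →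
    edgeCount G S ≡ 0 → ∀ u v → S u v ≡ false
  edgeCount≡0⇒empty S S-sym S-irrefl count≡0 u v = []₀₁≡0⇒false (begin
    [ S u v ]₀₁
      ≡⟨ ≺-orientations u v (S u v) loop ⟨
    [ u ≺ v ∧ S u v ]₀₁ + [ v ≺ u ∧ S u v ]₀₁
      ≡⟨ cong (λ s → [ u ≺ v ∧ S u v ]₀₁ + [ v ≺ u ∧ s ]₀₁) (S-sym u v) ⟩
    [ u ≺ v ∧ S u v ]₀₁ + [ v ≺ u ∧ S v u ]₀₁
      ≡⟨ cong₂ _+_ (oriented u v) (oriented v u) ⟩
    0 ∎)
    where
      open ≡-Reasoning
      oriented : ∀ u v → [ u ≺ v ∧ S u v ]₀₁ ≡ 0
      oriented u = Σ≡0⇒≡0 _ (Σ≡0⇒≡0 _ count≡0 u)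
      loop : u ≡ v → S u v ≡ false
      loop refl = S-irrefl u

  inducedEdges-sym : (X : VSubset G) → Symmetric (inducedEdges G X)
  inducedEdges-sym X u v rewrite adj-sym G u v with adj G v u | X u | X v
  ... | false | _     | _     = refl
  ... | true  | false | false = refl
  ... | true  | false | true  = refl
  ... | true  | true  | false = refl
  ... | true  | true  | true  = refl

  inducedEdges-irrefl : (X : VSubset G) → Irreflexive (inducedEdges G X)
  inducedEdges-irrefl X u rewrite adj-irrefl G u = refl

module Defect (G : Graph) (b : Fin (n G) → ℕ) (Z : VSubset G) (M : EdgeSubset G)
              (M-bmatching : IsBMatching G b M) where

  M⊆E : ∀ u v → M u v ≡ true → adj G u v ≡ true
  M⊆E = proj₁ M-bmatching

  M-sym : Symmetric M
  M-sym = proj₁ (proj₂ M-bmatching)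

  deg≤b : ∀ v → deg G M v ≤ b v
  deg≤b = proj₂ (proj₂ M-bmatching)

  M-irrefl : Irreflexive M
  M-irrefl u with M u u in uu∈M
  ... | false = refl
  ... | true  with () ← trans (sym (M⊆E u u uu∈M)) (adj-irrefl G u)

  Z̄ : VSubset G
  Z̄ = complement G Z

  unmatchedInside matchedOutside slackOutside defect : ℕ
  unmatchedInside = edgeCount G (λ u v → inducedEdges G Z u v ∧ not (M u v))
  matchedOutside  = edgeCount G (λ u v → M u v ∧ inducedEdges G Z̄ u v)
  slackOutside    = Σ[ (λ v → if Z̄ v then b v ∸ deg G M v else 0) ]
  defect          = unmatchedInside + matchedOutside + slackOutside

  matchedLeaving+matchedOutside :
    edgeCount G (λ u v → M u v ∧ not (inducedEdges G Z u v)) + matchedOutside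
    ≡ edgeCount G (λ u v → Z̄ u ∧ M u v) + edgeCount G (λ u v → Z̄ v ∧ M u v)
  matchedLeaving+matchedOutside =
    edgeCount-+ G (λ u v → split (M u v) (adj G u v) (Z u) (Z v) (M⊆E u v))
    where
      split : ∀ m a zu zv → (m ≡ true → a ≡ true) →
        [ m ∧ not (a ∧ zu ∧ zv) ]₀₁ + [ m ∧ (a ∧ not zu ∧ not zv) ]₀₁
        ≡ [ not zu ∧ m ]₀₁ + [ not zv ∧ m ]₀₁
      split false a zu zv _ rewrite ∧-zeroʳ (not zu) | ∧-zeroʳ (not zv) = refl
      split true  a zu zv m⇒a rewrite m⇒a refl with zu | zv
      ... | false | false = refl
      ... | false | true  = refl
      ... | true  | false = refl
      ... | true  | true  = refl

  size+defect : edgeCount G M + defect ≡ edgeCount G (inducedEdges G Z) + bOf G b Z̄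
  size+defect = begin
    ∣M∣ + ((X₁ + X₂) + X₃)       ≡⟨ +-assoc ∣M∣ (X₁ + X₂) X₃ ⟨
    (∣M∣ + (X₁ + X₂)) + X₃       ≡⟨ cong (_+ X₃) (+-assoc ∣M∣ X₁ X₂) ⟨
    ((∣M∣ + X₁) + X₂) + X₃       ≡⟨ cong (λ t → t + X₂ + X₃) (edgeCount-∖-exchange G M E[Z]) ⟩
    ((∣E∣ + leaving) + X₂) + X₃  ≡⟨ cong (_+ X₃) (+-assoc ∣E∣ leaving X₂) ⟩
    (∣E∣ + (leaving + X₂)) + X₃  ≡⟨ cong (λ t → ∣E∣ + t + X₃) matchedLeaving+matchedOutside ⟩
    (∣E∣ + (tails + heads)) + X₃ ≡⟨ cong (λ t → ∣E∣ + t + X₃) (edgeCount-ends G M M-sym M-irrefl Z̄) ⟩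
    (∣E∣ + degOutside) + X₃      ≡⟨ +-assoc ∣E∣ degOutside X₃ ⟩
    ∣E∣ + (degOutside + X₃)      ≡⟨ cong (∣E∣ +_) (Σ-if-+-∸ Z̄ deg≤b) ⟩
    ∣E∣ + bOf G b Z̄              ∎
    where
      open ≡-Reasoning
      E[Z] : EdgeSubset G
      E[Z] = inducedEdges G Z
      ∣M∣ ∣E∣ leaving tails heads degOutside X₁ X₂ X₃ : ℕ
      ∣M∣        = edgeCount G M
      ∣E∣        = edgeCount G E[Z]
      leaving    = edgeCount G (λ u v → M u v ∧ not (E[Z] u v))
      tails      = edgeCount G (λ u v → Z̄ u ∧ M u v)
      heads      = edgeCount G (λ u v → Z̄ v ∧ M u v)
      degOutside = Σ[ (λ u → if Z̄ u then deg G M u else 0) ]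
      X₁         = unmatchedInside
      X₂         = matchedOutside
      X₃         = slackOutside

  defect≡0 : IsBVerifying G b Z → (∀ M′ → IsBMatching G b M′ → edgeCount G M′ ≤ edgeCount G M) →
    defect ≡ 0
  defect≡0 (M₀ , (M₀-bmatching , _) , Z-verifies-M₀) M-maximum =
    n≤0⇒n≡0 (+-cancelˡ-≤ (edgeCount G M) defect 0 (begin
      edgeCount G M + defect                              ≡⟨ size+defect ⟩
      edgeCount G (inducedEdges G Z) + bOf G b Z̄          ≡⟨ +-comm _ (bOf G b Z̄) ⟩
      bOf G b Z̄ + edgeCount G (inducedEdges G Z)          ≡⟨ Z-verifies-M₀ ⟩
      edgeCount G M₀                                      ≤⟨ M-maximum M₀ M₀-bmatching ⟩
      edgeCount G M                                       ≡⟨ +-identityʳ (edgeCount G M) ⟨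
      edgeCount G M + 0                                   ∎))
    where open ≤-Reasoning

  module _ (no-defect : defect ≡ 0) where

    unmatchedInside≡0 : unmatchedInside ≡ 0
    unmatchedInside≡0 = m+n≡0⇒m≡0 unmatchedInside (m+n≡0⇒m≡0 (unmatchedInside + matchedOutside) no-defect)

    matchedOutside≡0 : matchedOutside ≡ 0
    matchedOutside≡0 = m+n≡0⇒n≡0 unmatchedInside (m+n≡0⇒m≡0 (unmatchedInside + matchedOutside) no-defect)

    slackOutside≡0 : slackOutside ≡ 0
    slackOutside≡0 = m+n≡0⇒n≡0 (unmatchedInside + matchedOutside) no-defect

    inside-matched : ∀ u v → inducedEdges G Z u v ≡ true → M u v ≡ true
    inside-matched u v uv∈E[Z] = not-injective (trans (cong (_∧ not (M u v)) (sym uv∈E[Z])) empty)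
      where
        empty : inducedEdges G Z u v ∧ not (M u v) ≡ false
        empty = edgeCount≡0⇒empty G _
          (λ u v → cong₂ (λ e m → e ∧ not m) (inducedEdges-sym G Z u v) (M-sym u v))
          (λ u → cong (_∧ not (M u u)) (inducedEdges-irrefl G Z u))
          unmatchedInside≡0 u v

    outside-unmatched : ∀ u v → inducedEdges G Z̄ u v ≡ true → M u v ≡ false
    outside-unmatched u v uv∈E[Z̄] =
      trans (sym (∧-identityʳ (M u v))) (trans (cong (M u v ∧_) (sym uv∈E[Z̄])) empty)
      where
        empty : M u v ∧ inducedEdges G Z̄ u v ≡ false
        empty = edgeCount≡0⇒empty G _
          (λ u v → cong₂ _∧_ (M-sym u v) (inducedEdges-sym G Z̄ u v))
          (λ u → cong (_∧ inducedEdges G Z̄ u u) (M-irrefl u))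
          matchedOutside≡0 u v

    loose⇒inside : ∀ v → IsLoose G b M v → Z v ≡ true
    loose⇒inside v v-loose with Σ≡0⇒≡0 _ slackOutside≡0 v
    ... | slack≡0 with Z v
    ... | true  = refl
    ... | false = ⊥-elim (<⇒≱ v-loose (m∸n≡0⇒m≤n slack≡0))

maximum-b-matching-structure : (G : Graph) (b : Fin (n G) → ℕ) (Z : VSubset G) →
  IsBVerifying G b Z → (M : EdgeSubset G) → IsMaxBMatching G b M →
    (∀ u v → inducedEdges G Z u v ≡ true → M u v ≡ true) ×
    (∀ u v → inducedEdges G (complement G Z) u v ≡ true → M u v ≡ false) ×
    (∀ v → IsLoose G b M v → Z v ≡ true)
maximum-b-matching-structure G b Z Z-verifying M (M-bmatching , M-maximum) =
  inside-matched no-defect , outside-unmatched no-defect , loose⇒inside no-defect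
  where
    open Defect G b Z M M-bmatching
    no-defect : defect ≡ 0
    no-defect = defect≡0 Z-verifying M-maximum

mainTheorem9 : (G : Graph) → IsBipartite G → (b : Fin (n G) → ℕ) → (Z : VSubset G) →
    IsBVerifying G b Z →
    ((M : EdgeSubset G) → IsMaxBMatching G b M →
        ((∀ u v → inducedEdges G Z u v ≡ true → M u v ≡ true) ×
         (∀ u v → inducedEdges G (complement G Z) u v ≡ true → M u v ≡ false) ×
         (∀ v → IsLoose G b M v → Z v ≡ true)))
    × (∀ u v → inducedEdges G Z u v ≡ true → Inevitable G b u v)
    × (∀ u v → inducedEdges G (complement G Z) u v ≡ true → Forbidden G b u v)
mainTheorem9 G _ b Z Z-verifying@(M₀ , M₀-maximum , _) =
  maximum-b-matching-structure G b Z Z-verifying , inevitable , forbidden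
  where
    inside-matched : ∀ M → IsMaxBMatching G b M → ∀ u v → inducedEdges G Z u v ≡ true → M u v ≡ true
    inside-matched M M-maximum = proj₁ (maximum-b-matching-structure G b Z Z-verifying M M-maximum)

    outside-unmatched : ∀ M → IsMaxBMatching G b M →
      ∀ u v → inducedEdges G (complement G Z) u v ≡ true → M u v ≡ false
    outside-unmatched M M-maximum = proj₁ (proj₂ (maximum-b-matching-structure G b Z Z-verifying M M-maximum))

    inevitable : ∀ u v → inducedEdges G Z u v ≡ true → Inevitable G b u v
    inevitable u v uv∈E[Z] =
      (M₀ , M₀-maximum , inside-matched M₀ M₀-maximum u v uv∈E[Z]) ,
      λ M M-maximum → inside-matched M M-maximum u v uv∈E[Z]

    forbidden : ∀ u v → inducedEdges G (complement G Z) u v ≡ true → Forbidden G b u v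
    forbidden u v uv∈E[Z̄] (M , M-maximum , uv∈M)
      with () ← trans (sym uv∈M) (outside-unmatched M M-maximum u v uv∈E[Z̄])
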